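{- Suppose $\Gamma\vdash r:A$ and $\Gamma\vdash\theta$. Then $\Gamma\vdash r\theta:A$.
   Context: Contextual modal type system. Disjoint countably infinite sets $\mathbb A$ (atoms) and $\mathbb X$ (unknowns). Types: $A::=o\mid\mathbb N\mid A\to A\mid [A_1,\dots,A_n]A$. Constants $C$ with types. Terms: $r::=C\mid a\mid\lambda a{:}A.r\mid rr\mid [a_1{:}A_1,\dots,a_n{:}A_n]r\mid X@(r_1,\dots,r_n)\mid \mathrm{letbox}\ X=s\ \mathrm{in}\ r$ (binders $\lambda a$, $[a_i{:}A_i]$, letbox $X$; up to $\alpha$-equivalence). Free atoms: $\mathrm{fa}(C)=\emptyset$, $\mathrm{fa}(a)=\{a\}$, $\mathrm{fa}(\lambda a{:}A.r)=\mathrm{fa}(r)\setminus\{a\}$, $\mathrm{fa}(rs)=\mathrm{fa}(r)\cup\mathrm{fa}(s)$, $\mathrm{fa}([a_i{:}A_i]r)=\mathrm{fa}(r)\setminus\{a_i\}_i$, $\mathrm{fa}(\mathrm{letbox}\ X=s\ \mathrm{in}\ r)=\mathrm{fa}(r)\cup\mathrm{fa}(s)$, $\mathrm{fa}(X@(s_i))=\bigcup_i\mathrm{fa}(s_i)$; free unknowns: $\mathrm{fv}(X@(s_i))=\{X\}\cup\bigcup\mathrm{fv}(s_i)$, letbox binds $X$, otherwise structural. Typing contexts: finite partial functions from $\mathbb A\cup\mathbb X$ to types. Rules: (Hyp) $\Gamma,a{:}A\vdash a:A$; (Const) $\Gamma\vdash C:\mathrm{type}(C)$; (${\to}$I), (${\to}$E)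 as in the simply typed $\lambda$-calculus; ([]I) from $\Gamma,a_1{:}A_1,\dots,a_n{:}A_n\vdash r:A$ and $\mathrm{fa}(r)\subseteq\{a_1,\dots,a_n\}$ infer $\Gamma\vdash[a_i{:}A_i]r:[A_i]A$; ([]E) from $\Gamma,X{:}[A_i]A\vdash r:B$ and $\Gamma\vdash s:[A_i]A$ infer $\Gamma\vdash\mathrm{letbox}\ X=s\ \mathrm{in}\ r:B$; (Ext) if $\Gamma,X{:}[A_1,\dots,A_n]A\vdash r_j:A_j$ ($1\le j\le n$) then $\Gamma,X{:}[A_1,\dots,A_n]A\vdash X@(r_1,\dots,r_n):A$. Atoms-substitution $[a_i{:=}t_i]_i$: simultaneous capture-avoiding substitution of terms for atoms, acting structurally, with $(X@(r_i))\sigma=X@(r_i\sigma)$. An unknowns-substitution $\theta$ is a finite partial function from $\mathbb X$ to terms with each $\theta(X)=[a_1{:}A_1,\dots,a_n{:}A_n]r'$ where $\mathrm{fa}(r')\subseteq\{a_1,\dots,a_n\}$; $\mathrm{fv}(\theta)=\mathrm{dom}\theta\cup\bigcup\mathrm{fv}(\theta(X))$. Action: $C\theta=C$, $a\theta=a$, $(rs)\theta=(r\theta)(s\theta)$, $([a_i{:}A_i]r)\theta=[a_i{:}A_i](r\theta)$, $(\lambda c{:}A.r)\theta=\lambda c{:}A.(r\theta)$, $(X@(r_i)_i)\theta=s'[a_i{:=}r_i\theta]_i$ if $\theta(X)=[a_i{:}A_i]s'$ (defined when arities match), $(X@(r_i))\theta=X@(r_i\theta)$ if $X\notin\mathrm{dom}\theta$,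 $(\mathrm{letbox}\ Y=s\ \mathrm{in}\ r)\theta=\mathrm{letbox}\ Y=s\theta\ \mathrm{in}\ r\theta$ ($Y\notin\mathrm{fv}(\theta)$). $\Gamma\vdash\theta$ means: for every $X\in\mathrm{dom}\theta$, $\Gamma(X)=[A_i]A$ for some $[A_i]A$ and $\Gamma\vdash\theta(X):[A_i]A$. -}

module Defs where

-- Contextual modal type system, in a locally nameless / de Bruijn presentation
-- (terms up to alpha-equivalence). Atoms and unknowns are two disjoint
-- kinds of variables, each with its own de Bruijn indices.

open import Data.Nat using (ℕ; zero; suc; _+_; _∸_; _<_)
open import Data.List using (List; []; _∷_; _++_; length)
open import Data.Maybe using (Maybe; just; nothing)
open import Data.Product using (Σ; _×_; _,_; ∃-syntax)
open import Data.Sum using (_⊎_)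
open import Relation.Binary.PropositionalEquality using (_≡_)

data Ty : Set where
  o    : Ty
  nat  : Ty
  _⇒_  : Ty → Ty → Ty
  [_]_ : List Ty → Ty → Ty

infixr 7 _⇒_

record Sig : Set₁ where
  field
    Const : Set
    type  : Const → Ty
open Sig public

-- Terms.
--   atom a        : a de Bruijn index for an atom
--   lam A r       : λ a:A. r            (binds one atom)
--   app r s       : r s
--   box As r      : [a₁:A₁,…,aₙ:Aₙ] r  (binds n atoms; aᵢ is index i-1)
--   ext X rs      : X@(r₁,…,rₙ)         (X a de Bruijn index for an unknown)
--   letbox s r    : letbox X = s in r   (binds one unknown in r)

data Term (S : Sig) : Set where
  const  : Const S → Term S
  atom   : ℕ → Term S
  lam    : Ty → Term S → Term S
  app    : Term S → Term S → Term S
  box    : List Ty → Term S → Term S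
  ext    : ℕ → List (Term S) → Term S
  letbox : Term S → Term S → Term S

mutual
  data _∈fa_ {S : Sig} : ℕ → Term S → Set where
    fa-atom   : ∀ {a} → a ∈fa atom a
    fa-lam    : ∀ {a A r} → suc a ∈fa r → a ∈fa lam A r
    fa-appˡ   : ∀ {a r s} → a ∈fa r → a ∈fa app r s
    fa-appʳ   : ∀ {a r s} → a ∈fa s → a ∈fa app r s
    fa-box    : ∀ {a As r} → (length As + a) ∈fa r → a ∈fa box As r
    fa-ext    : ∀ {a X rs} → a ∈fa* rs → a ∈fa ext X rs
    fa-letˢ   : ∀ {a s r} → a ∈fa s → a ∈fa letbox s r
    fa-letʳ   : ∀ {a s r} → a ∈fa r → a ∈fa letbox s r

  data _∈fa*_ {S : Sig} : ℕ → List (Term S) → Set where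
    here  : ∀ {a r rs} → a ∈fa r → a ∈fa* (r ∷ rs)
    there : ∀ {a r rs} → a ∈fa* rs → a ∈fa* (r ∷ rs)

-- Typing contexts: a list of atom types and a list of unknown types
-- (de Bruijn: index 0 is the most recently added).

record Ctx : Set where
  constructor ⟨_∣_⟩
  field
    atoms : List Ty
    unks  : List Ty
open Ctx public

_!_ : {A : Set} → List A → ℕ → Maybe A
[]       ! _     = nothing
(x ∷ xs) ! zero  = just x
(x ∷ xs) ! suc n = xs ! n

mutual
  data _⊢_∶_ {S : Sig} (Γ : Ctx) : Term S → Ty → Set where
    Hyp   : ∀ {a A} → atoms Γ ! a ≡ just A → Γ ⊢ atom a ∶ A
    Cst   : ∀ {c} → Γ ⊢ const c ∶ type S c
    →I    : ∀ {A B r} → ⟨ A ∷ atoms Γ ∣ unks Γ ⟩ ⊢ r ∶ B → Γ ⊢ lam A r ∶ (A ⇒ B)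
    →E    : ∀ {A B r s} → Γ ⊢ r ∶ (A ⇒ B) → Γ ⊢ s ∶ A → Γ ⊢ app r s ∶ B
    []I   : ∀ {As A r} → ⟨ As ++ atoms Γ ∣ unks Γ ⟩ ⊢ r ∶ A
          → (∀ a → a ∈fa r → a < length As)
          → Γ ⊢ box As r ∶ ([ As ] A)
    []E   : ∀ {As A B r s} → ⟨ atoms Γ ∣ ([ As ] A) ∷ unks Γ ⟩ ⊢ r ∶ B
          → Γ ⊢ s ∶ ([ As ] A)
          → Γ ⊢ letbox s r ∶ B
    Ext   : ∀ {X As A rs} → unks Γ ! X ≡ just ([ As ] A)
          → Γ ⊢* rs ∶ As
          → Γ ⊢ ext X rs ∶ A

  data _⊢*_∶_ {S : Sig} (Γ : Ctx) : List (Term S) → List Ty → Set where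
    []  : Γ ⊢* [] ∶ []
    _∷_ : ∀ {r rs A As} → Γ ⊢ r ∶ A → Γ ⊢* rs ∶ As → Γ ⊢* (r ∷ rs) ∶ (A ∷ As)

liftR : (ℕ → ℕ) → ℕ → ℕ
liftR ρ zero    = zero
liftR ρ (suc n) = suc (ρ n)

liftRⁿ : ℕ → (ℕ → ℕ) → ℕ → ℕ
liftRⁿ zero    ρ = ρ
liftRⁿ (suc k) ρ = liftR (liftRⁿ k ρ)

mutual
  renA : {S : Sig} → (ℕ → ℕ) → Term S → Term S
  renA ρ (const c)    = const c
  renA ρ (atom a)     = atom (ρ a)
  renA ρ (lam A r)    = lam A (renA (liftR ρ) r)
  renA ρ (app r s)    = app (renA ρ r) (renA ρ s)
  renA ρ (box As r)   = box As (renA (liftRⁿ (length As) ρ) r)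
  renA ρ (ext X rs)   = ext X (renA* ρ rs)
  renA ρ (letbox s r) = letbox (renA ρ s) (renA ρ r)

  renA* : {S : Sig} → (ℕ → ℕ) → List (Term S) → List (Term S)
  renA* ρ []       = []
  renA* ρ (r ∷ rs) = renA ρ r ∷ renA* ρ rs

mutual
  renU : {S : Sig} → (ℕ → ℕ) → Term S → Term S
  renU ρ (const c)    = const c
  renU ρ (atom a)     = atom a
  renU ρ (lam A r)    = lam A (renU ρ r)
  renU ρ (app r s)    = app (renU ρ r) (renU ρ s)
  renU ρ (box As r)   = box As (renU ρ r)
  renU ρ (ext X rs)   = ext (ρ X) (renU* ρ rs)
  renU ρ (letbox s r) = letbox (renU ρ s) (renU (liftR ρ) r)

  renU* : {S : Sig} → (ℕ → ℕ) → List (Term S) → List (Term S)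
  renU* ρ []       = []
  renU* ρ (r ∷ rs) = renU ρ r ∷ renU* ρ rs

liftS : {S : Sig} → (ℕ → Term S) → ℕ → Term S
liftS σ zero    = atom zero
liftS σ (suc n) = renA suc (σ n)

liftSⁿ : {S : Sig} → ℕ → (ℕ → Term S) → ℕ → Term S
liftSⁿ zero    σ = σ
liftSⁿ (suc k) σ = liftS (liftSⁿ k σ)

mutual
  subA : {S : Sig} → (ℕ → Term S) → Term S → Term S
  subA σ (const c)    = const c
  subA σ (atom a)     = σ a
  subA σ (lam A r)    = lam A (subA (liftS σ) r)
  subA σ (app r s)    = app (subA σ r) (subA σ s)
  subA σ (box As r)   = box As (subA (liftSⁿ (length As) σ) r)
  subA σ (ext X rs)   = ext X (subA* σ rs)
  subA σ (letbox s r) = letbox (subA σ s) (subA (λ a → renU suc (σ a)) r)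

  subA* : {S : Sig} → (ℕ → Term S) → List (Term S) → List (Term S)
  subA* σ []       = []
  subA* σ (r ∷ rs) = subA σ r ∷ subA* σ rs

-- [a₁ := t₁, …, aₙ := tₙ] where aᵢ is atom index i-1 (the atoms bound by
-- a box [a₁:A₁,…,aₙ:Aₙ]); indices ≥ n are shifted down by n (they are
-- never used, since the body of θ(X) has no other free atoms).
inst : {S : Sig} → List (Term S) → ℕ → Term S
inst []       a       = atom a
inst (t ∷ ts) zero    = t
inst (t ∷ ts) (suc a) = inst ts a

-- Unknowns-substitutions: θ X = just (As , r') represents
-- θ(X) = [a₁:A₁,…,aₙ:Aₙ] r'; θ X = nothing means X ∉ dom θ.

USub : Sig → Set
USub S = ℕ → Maybe (List Ty × Term S)

-- the side condition fa(r') ⊆ {a₁,…,aₙ}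
IsUSub : {S : Sig} → USub S → Set
IsUSub θ = ∀ X As r' → θ X ≡ just (As , r') → ∀ a → a ∈fa r' → a < length As

-- pushing θ under a letbox binder (the bound unknown is not in dom θ and
-- not free in θ)
liftθ : {S : Sig} → USub S → USub S
liftθ θ zero = nothing
liftθ θ (suc X) with θ X
... | nothing        = nothing
... | just (As , r') = just (As , renU suc r')

mutual
  _⟪_⟫ : {S : Sig} → Term S → USub S → Term S
  const c ⟪ θ ⟫    = const c
  atom a ⟪ θ ⟫     = atom a
  lam A r ⟪ θ ⟫    = lam A (r ⟪ θ ⟫)
  app r s ⟪ θ ⟫    = app (r ⟪ θ ⟫) (s ⟪ θ ⟫)
  box As r ⟪ θ ⟫   = box As (r ⟪ θ ⟫)
  ext X rs ⟪ θ ⟫ with θ X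
  ... | just (As , s') = subA (inst (rs ⟪ θ ⟫*)) s'
  ... | nothing        = ext X (rs ⟪ θ ⟫*)
  letbox s r ⟪ θ ⟫ = letbox (s ⟪ θ ⟫) (r ⟪ liftθ θ ⟫)

  _⟪_⟫* : {S : Sig} → List (Term S) → USub S → List (Term S)
  [] ⟪ θ ⟫*       = []
  (r ∷ rs) ⟪ θ ⟫* = (r ⟪ θ ⟫) ∷ (rs ⟪ θ ⟫*)

_⊢ˢ_ : {S : Sig} → Ctx → USub S → Set
Γ ⊢ˢ θ = ∀ X As r' → θ X ≡ just (As , r') →
  ∃[ Bs ] ∃[ A ] (unks Γ ! X ≡ just ([ Bs ] A) × Γ ⊢ box As r' ∶ ([ Bs ] A))

module Submission where

-- The only
-- interesting case is X@(r₁,…,rₙ) with θ(X) = [a₁:A₁,…,aₙ:Aₙ]s', where the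
-- result is the atoms-substitution s'[aᵢ := rᵢθ].

open import Defs
open import Data.Nat using (ℕ; zero; suc; _+_; _<_; s≤s)
open import Data.Nat.Properties using (suc-injective)
open import Data.List using (List; []; _∷_; _++_; length)
open import Data.Maybe using (just; nothing)
open import Data.Product using (_×_; _,_; ∃-syntax; proj₁; proj₂)
open import Relation.Binary.PropositionalEquality using (_≡_; refl; sym; trans; cong; subst)

private
  variable
    S : Sig
    Γ : Ctx
    Φ Φ' Ψ Ψ' As : List Ty
    A C : Ty
    r : Term S
    rs : List (Term S)

!-++-< : {X : Set} (As : List X) (Φ Φ' : List X) (a : ℕ) → a < length As
  → (As ++ Φ) ! a ≡ (As ++ Φ') ! a
!-++-< (_ ∷ As) Φ Φ' zero    _       = refl
!-++-< (_ ∷ As) Φ Φ' (suc a) (s≤s p) = !-++-< As Φ Φ' a p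

agree-++ : {X : Set} (As : List X) {Φ Φ' : List X} (P : ℕ → Set)
  → (∀ a → P (length As + a) → Φ ! a ≡ Φ' ! a)
  → ∀ a → P a → (As ++ Φ) ! a ≡ (As ++ Φ') ! a
agree-++ []       P h a       p = h a p
agree-++ (_ ∷ As) P h zero    p = refl
agree-++ (_ ∷ As) P h (suc a) p = agree-++ As (λ b → P (suc b)) h a p

mutual
  agree-fa : ⟨ Φ ∣ Ψ ⟩ ⊢ r ∶ A → (∀ a → a ∈fa r → Φ ! a ≡ Φ' ! a) → ⟨ Φ' ∣ Ψ ⟩ ⊢ r ∶ A
  agree-fa (Hyp p)    h = Hyp (trans (sym (h _ fa-atom)) p)
  agree-fa Cst        h = Cst
  agree-fa (→I {A = A} {r = r} d) h =
    →I (agree-fa d (agree-++ (A ∷ []) (_∈fa r) (λ a q → h a (fa-lam q))))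
  agree-fa (→E d e)   h = →E (agree-fa d (λ a q → h a (fa-appˡ q))) (agree-fa e (λ a q → h a (fa-appʳ q)))
  agree-fa ([]I {As = As} {r = r} d f) h =
    []I (agree-fa d (agree-++ As (_∈fa r) (λ a q → h a (fa-box q)))) f
  agree-fa ([]E d e)  h = []E (agree-fa d (λ a q → h a (fa-letʳ q))) (agree-fa e (λ a q → h a (fa-letˢ q)))
  agree-fa (Ext p ts) h = Ext p (agree-fa* ts (λ a q → h a (fa-ext q)))

  agree-fa* : ⟨ Φ ∣ Ψ ⟩ ⊢* rs ∶ As → (∀ a → a ∈fa* rs → Φ ! a ≡ Φ' ! a) → ⟨ Φ' ∣ Ψ ⟩ ⊢* rs ∶ As
  agree-fa* []       h = []
  agree-fa* (d ∷ ds) h = agree-fa d (λ a q → h a (here q)) ∷ agree-fa* ds (λ a q → h a (there q))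

-- A box has no free atoms, so its typing is independent of the atom context.
box-any-atoms : ⟨ Φ ∣ Ψ ⟩ ⊢ box As r ∶ A → ⟨ Φ' ∣ Ψ ⟩ ⊢ box As r ∶ A
box-any-atoms ([]I {As = As} d f) = []I (agree-fa d (λ a q → !-++-< As _ _ a (f a q))) f

UnkRenaming : List Ty → List Ty → (ℕ → ℕ) → Set
UnkRenaming Ψ Ψ' ρ = ∀ X C → Ψ ! X ≡ just C → Ψ' ! ρ X ≡ just C

weaken-unks : ∀ C Ψ → UnkRenaming Ψ (C ∷ Ψ) suc
weaken-unks _ _ _ _ p = p

lift-unk-renaming : ∀ {ρ} → UnkRenaming Ψ Ψ' ρ → UnkRenaming (C ∷ Ψ) (C ∷ Ψ') (liftR ρ)
lift-unk-renaming h zero    _ p = p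
lift-unk-renaming h (suc X) _ p = h X _ p

mutual
  fa-renU : ∀ {ρ a} (r : Term S) → a ∈fa renU ρ r → a ∈fa r
  fa-renU (atom b)     fa-atom    = fa-atom
  fa-renU (lam A r)    (fa-lam q) = fa-lam (fa-renU r q)
  fa-renU (app r s)    (fa-appˡ q) = fa-appˡ (fa-renU r q)
  fa-renU (app r s)    (fa-appʳ q) = fa-appʳ (fa-renU s q)
  fa-renU (box As r)   (fa-box q) = fa-box (fa-renU r q)
  fa-renU (ext X rs)   (fa-ext q) = fa-ext (fa-renU* rs q)
  fa-renU (letbox s r) (fa-letˢ q) = fa-letˢ (fa-renU s q)
  fa-renU (letbox s r) (fa-letʳ q) = fa-letʳ (fa-renU r q)

  fa-renU* : ∀ {ρ a} (rs : List (Term S)) → a ∈fa* renU* ρ rs → a ∈fa* rs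
  fa-renU* (r ∷ rs) (here q)  = here (fa-renU r q)
  fa-renU* (r ∷ rs) (there q) = there (fa-renU* rs q)

mutual
  ty-renU : ∀ {ρ} → ⟨ Φ ∣ Ψ ⟩ ⊢ r ∶ A → UnkRenaming Ψ Ψ' ρ → ⟨ Φ ∣ Ψ' ⟩ ⊢ renU ρ r ∶ A
  ty-renU (Hyp p)    h = Hyp p
  ty-renU Cst        h = Cst
  ty-renU (→I d)     h = →I (ty-renU d h)
  ty-renU (→E d e)   h = →E (ty-renU d h) (ty-renU e h)
  ty-renU ([]I {r = r} d f) h = []I (ty-renU d h) (λ a q → f a (fa-renU r q))
  ty-renU ([]E d e)  h = []E (ty-renU d (lift-unk-renaming h)) (ty-renU e h)
  ty-renU (Ext p ts) h = Ext (h _ _ p) (ty-renU* ts h)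

  ty-renU* : ∀ {ρ} → ⟨ Φ ∣ Ψ ⟩ ⊢* rs ∶ As → UnkRenaming Ψ Ψ' ρ → ⟨ Φ ∣ Ψ' ⟩ ⊢* renU* ρ rs ∶ As
  ty-renU* []       h = []
  ty-renU* (d ∷ ds) h = ty-renU d h ∷ ty-renU* ds h

AtomRenaming : List Ty → List Ty → (ℕ → ℕ) → Set
AtomRenaming Φ Φ' ρ = ∀ a B → Φ ! a ≡ just B → Φ' ! ρ a ≡ just B

weaken-atoms : ∀ C Φ → AtomRenaming Φ (C ∷ Φ) suc
weaken-atoms _ _ _ _ p = p

lift-atom-renaming : ∀ {ρ} As → AtomRenaming Φ Φ' ρ
  → AtomRenaming (As ++ Φ) (As ++ Φ') (liftRⁿ (length As) ρ)
lift-atom-renaming []       h = h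
lift-atom-renaming (_ ∷ As) h zero    _ p = p
lift-atom-renaming (_ ∷ As) h (suc a) _ p = lift-atom-renaming As h a _ p

liftRⁿ-bound : ∀ n ρ b → b < n → liftRⁿ n ρ b ≡ b
liftRⁿ-bound (suc n) ρ zero    _       = refl
liftRⁿ-bound (suc n) ρ (suc b) (s≤s p) = cong suc (liftRⁿ-bound n ρ b p)

liftRⁿ-free : ∀ n ρ b a → liftRⁿ n ρ b ≡ n + a → ∃[ b' ] (b ≡ n + b' × ρ b' ≡ a)
liftRⁿ-free zero    ρ b       a p = b , refl , p
liftRⁿ-free (suc n) ρ (suc b) a p with liftRⁿ-free n ρ b a (suc-injective p)
... | b' , refl , q = b' , refl , q

mutual
  fa-renA : ∀ ρ {a} (r : Term S) → a ∈fa renA ρ r → ∃[ b ] (b ∈fa r × ρ b ≡ a)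
  fa-renA ρ (atom b) fa-atom = b , fa-atom , refl
  fa-renA ρ (lam A r) (fa-lam q) with fa-renA (liftR ρ) r q
  ... | b , q' , e with liftRⁿ-free 1 ρ b _ e
  ...   | b' , refl , e' = b' , fa-lam q' , e'
  fa-renA ρ (app r s) (fa-appˡ q) with fa-renA ρ r q
  ... | b , q' , e = b , fa-appˡ q' , e
  fa-renA ρ (app r s) (fa-appʳ q) with fa-renA ρ s q
  ... | b , q' , e = b , fa-appʳ q' , e
  fa-renA ρ (box As r) (fa-box q) with fa-renA (liftRⁿ (length As) ρ) r q
  ... | b , q' , e with liftRⁿ-free (length As) ρ b _ e
  ...   | b' , refl , e' = b' , fa-box q' , e'
  fa-renA ρ (ext X rs) (fa-ext q) with fa-renA* ρ rs q
  ... | b , q' , e = b , fa-ext q' , e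
  fa-renA ρ (letbox s r) (fa-letˢ q) with fa-renA ρ s q
  ... | b , q' , e = b , fa-letˢ q' , e
  fa-renA ρ (letbox s r) (fa-letʳ q) with fa-renA ρ r q
  ... | b , q' , e = b , fa-letʳ q' , e

  fa-renA* : ∀ ρ {a} (rs : List (Term S)) → a ∈fa* renA* ρ rs → ∃[ b ] (b ∈fa* rs × ρ b ≡ a)
  fa-renA* ρ (r ∷ rs) (here q) with fa-renA ρ r q
  ... | b , q' , e = b , here q' , e
  fa-renA* ρ (r ∷ rs) (there q) with fa-renA* ρ rs q
  ... | b , q' , e = b , there q' , e

mutual
  ty-renA : ∀ {ρ} → ⟨ Φ ∣ Ψ ⟩ ⊢ r ∶ A → AtomRenaming Φ Φ' ρ → ⟨ Φ' ∣ Ψ ⟩ ⊢ renA ρ r ∶ A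
  ty-renA (Hyp p)   h = Hyp (h _ _ p)
  ty-renA Cst       h = Cst
  ty-renA (→I {A = A} d) h = →I (ty-renA d (lift-atom-renaming (A ∷ []) h))
  ty-renA (→E d e)  h = →E (ty-renA d h) (ty-renA e h)
  ty-renA {ρ = ρ} ([]I {As = As} {r = r} d f) h = []I (ty-renA d (lift-atom-renaming As h)) closed
    where
    -- the bound atoms are fixed by the lifted renaming
    closed : ∀ a → a ∈fa renA (liftRⁿ (length As) ρ) r → a < length As
    closed a q with fa-renA (liftRⁿ (length As) ρ) r q
    ... | b , q' , e = subst (_< length As) (trans (sym (liftRⁿ-bound (length As) ρ b (f b q'))) e) (f b q')
  ty-renA ([]E d e)  h = []E (ty-renA d h) (ty-renA e h)
  ty-renA (Ext p ts) h = Ext p (ty-renA* ts h)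

  ty-renA* : ∀ {ρ} → ⟨ Φ ∣ Ψ ⟩ ⊢* rs ∶ As → AtomRenaming Φ Φ' ρ → ⟨ Φ' ∣ Ψ ⟩ ⊢* renA* ρ rs ∶ As
  ty-renA* []       h = []
  ty-renA* (d ∷ ds) h = ty-renA d h ∷ ty-renA* ds h

AtomSubst : List Ty → Ctx → (ℕ → Term S) → Set
AtomSubst Φ Δ σ = ∀ a B → Φ ! a ≡ just B → Δ ⊢ σ a ∶ B

lift-atom-subst : ∀ {σ : ℕ → Term S} As → AtomSubst Φ ⟨ Φ' ∣ Ψ ⟩ σ
  → AtomSubst (As ++ Φ) ⟨ As ++ Φ' ∣ Ψ ⟩ (liftSⁿ (length As) σ)
lift-atom-subst []       h = h
lift-atom-subst (_ ∷ As) h zero    _ p = Hyp p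
lift-atom-subst {Φ = Φ} {Φ' = Φ'} (C ∷ As) h (suc a) _ p =
  ty-renA (lift-atom-subst {Φ = Φ} As h a _ p) (weaken-atoms C (As ++ Φ'))

weaken-atom-subst : ∀ {σ : ℕ → Term S} → AtomSubst Φ ⟨ Φ' ∣ Ψ ⟩ σ
  → AtomSubst Φ ⟨ Φ' ∣ C ∷ Ψ ⟩ (λ a → renU suc (σ a))
weaken-atom-subst {Ψ = Ψ} {C = C} h a B p = ty-renU (h a B p) (weaken-unks C Ψ)

liftSⁿ-bound : ∀ n (σ : ℕ → Term S) b a → b < n → a ∈fa liftSⁿ n σ b → a ≡ b
liftSⁿ-bound (suc n) σ zero    a _       fa-atom = refl
liftSⁿ-bound (suc n) σ (suc b) a (s≤s p) q with fa-renA suc (liftSⁿ n σ b) q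
... | c , q' , e = trans (sym e) (cong suc (liftSⁿ-bound n σ b c p q'))

liftSⁿ-free : ∀ n (σ : ℕ → Term S) b a → (n + a) ∈fa liftSⁿ n σ b → ∃[ b' ] (b ≡ n + b' × a ∈fa σ b')
liftSⁿ-free zero    σ b       a q = b , refl , q
liftSⁿ-free (suc n) σ (suc b) a q with fa-renA suc (liftSⁿ n σ b) q
... | c , q' , e with liftSⁿ-free n σ b a (subst (_∈fa liftSⁿ n σ b) (suc-injective e) q')
...   | b' , refl , q'' = b' , refl , q''

mutual
  fa-subA : ∀ (σ : ℕ → Term S) {a} (r : Term S) → a ∈fa subA σ r → ∃[ b ] (b ∈fa r × a ∈fa σ b)
  fa-subA σ (atom b) q = b , fa-atom , q
  fa-subA σ (lam A r) (fa-lam q) with fa-subA (liftS σ) r q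
  ... | b , q' , q'' with liftSⁿ-free 1 σ b _ q''
  ...   | b' , refl , q₃ = b' , fa-lam q' , q₃
  fa-subA σ (app r s) (fa-appˡ q) with fa-subA σ r q
  ... | b , q' , e = b , fa-appˡ q' , e
  fa-subA σ (app r s) (fa-appʳ q) with fa-subA σ s q
  ... | b , q' , e = b , fa-appʳ q' , e
  fa-subA σ (box As r) (fa-box q) with fa-subA (liftSⁿ (length As) σ) r q
  ... | b , q' , q'' with liftSⁿ-free (length As) σ b _ q''
  ...   | b' , refl , q₃ = b' , fa-box q' , q₃
  fa-subA σ (ext X rs) (fa-ext q) with fa-subA* σ rs q
  ... | b , q' , e = b , fa-ext q' , e
  fa-subA σ (letbox s r) (fa-letˢ q) with fa-subA σ s q
  ... | b , q' , e = b , fa-letˢ q' , e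
  fa-subA σ (letbox s r) (fa-letʳ q) with fa-subA (λ a → renU suc (σ a)) r q
  ... | b , q' , e = b , fa-letʳ q' , fa-renU (σ b) e

  fa-subA* : ∀ (σ : ℕ → Term S) {a} (rs : List (Term S)) → a ∈fa* subA* σ rs → ∃[ b ] (b ∈fa* rs × a ∈fa σ b)
  fa-subA* σ (r ∷ rs) (here q) with fa-subA σ r q
  ... | b , q' , e = b , here q' , e
  fa-subA* σ (r ∷ rs) (there q) with fa-subA* σ rs q
  ... | b , q' , e = b , there q' , e

mutual
  ty-subA : ∀ {σ : ℕ → Term S} → ⟨ Φ ∣ Ψ ⟩ ⊢ r ∶ A → AtomSubst Φ ⟨ Φ' ∣ Ψ ⟩ σ → ⟨ Φ' ∣ Ψ ⟩ ⊢ subA σ r ∶ A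
  ty-subA (Hyp p)   h = h _ _ p
  ty-subA Cst       h = Cst
  ty-subA (→I {A = A} d) h = →I (ty-subA d (lift-atom-subst (A ∷ []) h))
  ty-subA (→E d e)  h = →E (ty-subA d h) (ty-subA e h)
  ty-subA {σ = σ} ([]I {As = As} {r = r} d f) h = []I (ty-subA d (lift-atom-subst As h)) closed
    where
    -- the bound atoms are substituted by themselves
    closed : ∀ a → a ∈fa subA (liftSⁿ (length As) σ) r → a < length As
    closed a q with fa-subA (liftSⁿ (length As) σ) r q
    ... | b , q' , q'' = subst (_< length As) (sym (liftSⁿ-bound (length As) σ b a (f b q') q'')) (f b q')
  ty-subA {Φ = Φ} ([]E d e) h = []E (ty-subA d (weaken-atom-subst {Φ = Φ} h)) (ty-subA e h)
  ty-subA (Ext p ts) h = Ext p (ty-subA* ts h)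

  ty-subA* : ∀ {σ : ℕ → Term S} → ⟨ Φ ∣ Ψ ⟩ ⊢* rs ∶ As → AtomSubst Φ ⟨ Φ' ∣ Ψ ⟩ σ → ⟨ Φ' ∣ Ψ ⟩ ⊢* subA* σ rs ∶ As
  ty-subA* []       h = []
  ty-subA* (d ∷ ds) h = ty-subA d h ∷ ty-subA* ds h

ty-inst : ∀ {ts : List (Term S)} → ⟨ Φ ∣ Ψ ⟩ ⊢* ts ∶ As → AtomSubst (As ++ Φ) ⟨ Φ ∣ Ψ ⟩ (inst ts)
ty-inst []       a       _ p    = Hyp p
ty-inst (d ∷ ds) zero    _ refl = d
ty-inst (d ∷ ds) (suc a) _ p    = ty-inst ds a _ p

fa-inst : ∀ (ts : List (Term S)) b {a} → b < length ts → a ∈fa inst ts b → a ∈fa* ts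
fa-inst (t ∷ ts) zero    _       q = here q
fa-inst (t ∷ ts) (suc b) (s≤s p) q = there (fa-inst ts b p q)

length-⊢* : ∀ {ts : List (Term S)} → Γ ⊢* ts ∶ As → length As ≡ length ts
length-⊢* []       = refl
length-⊢* (d ∷ ds) = cong suc (length-⊢* ds)

length-⟪⟫* : ∀ (ts : List (Term S)) (θ : USub S) → length ts ≡ length (ts ⟪ θ ⟫*)
length-⟪⟫* []       θ = refl
length-⟪⟫* (t ∷ ts) θ = cong suc (length-⟪⟫* ts θ)

-- An entry θ(X) = [a₁,…,aₙ]s' at an unknown X : [A₁,…,Aₙ]A of Γ has a body
-- s' : A over the atoms aᵢ : Aᵢ, and no other free atoms.  (In particular
-- Γ ⊢ θ already implies the side condition IsUSub θ.)
entry : ∀ {θ : USub S} {X As' s' Bs} → Γ ⊢ˢ θ → θ X ≡ just (As' , s') → unks Γ ! X ≡ just ([ Bs ] A)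
  → ⟨ Bs ++ atoms Γ ∣ unks Γ ⟩ ⊢ s' ∶ A × (∀ a → a ∈fa s' → a < length Bs)
entry hθ eq p with hθ _ _ _ eq
... | _ , _ , p' , []I d f with trans (sym p) p'
...   | refl = d , f

-- The entries are closed, so Γ ⊢ θ holds for any atom context.
θ-any-atoms : ∀ {θ : USub S} → ⟨ Φ ∣ Ψ ⟩ ⊢ˢ θ → ⟨ Φ' ∣ Ψ ⟩ ⊢ˢ θ
θ-any-atoms hθ X As r eq with hθ X As r eq
... | Bs , A , p , d = Bs , A , p , box-any-atoms d

lift-θ : ∀ {θ : USub S} → ⟨ Φ ∣ Ψ ⟩ ⊢ˢ θ → ⟨ Φ ∣ C ∷ Ψ ⟩ ⊢ˢ liftθ θ
lift-θ hθ zero _ _ ()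
lift-θ {θ = θ} hθ (suc Y) As _ eq with θ Y in e
lift-θ hθ (suc Y) As _ ()   | nothing
lift-θ {Ψ = Ψ} {C = C} hθ (suc Y) As _ refl | just (_ , r₀) with hθ Y As r₀ e
... | Bs , A , p , d = Bs , A , p , ty-renU d (weaken-unks C Ψ)

mutual
  fa-⟪⟫ : ∀ {θ : USub S} {a} → ⟨ Φ ∣ Ψ ⟩ ⊢ r ∶ A → ⟨ Φ ∣ Ψ ⟩ ⊢ˢ θ → a ∈fa (r ⟪ θ ⟫) → a ∈fa r
  fa-⟪⟫ (Hyp p)   hθ q            = q
  fa-⟪⟫ (→I d)    hθ (fa-lam q)  = fa-lam (fa-⟪⟫ d (θ-any-atoms hθ) q)
  fa-⟪⟫ (→E d e)  hθ (fa-appˡ q) = fa-appˡ (fa-⟪⟫ d hθ q)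
  fa-⟪⟫ (→E d e)  hθ (fa-appʳ q) = fa-appʳ (fa-⟪⟫ e hθ q)
  fa-⟪⟫ ([]I d f) hθ (fa-box q)  = fa-box (fa-⟪⟫ d (θ-any-atoms hθ) q)
  fa-⟪⟫ ([]E d e) hθ (fa-letˢ q) = fa-letˢ (fa-⟪⟫ e hθ q)
  fa-⟪⟫ ([]E d e) hθ (fa-letʳ q) = fa-letʳ (fa-⟪⟫ d (lift-θ hθ) q)
  fa-⟪⟫ {θ = θ} (Ext {X = X} p ts) hθ q with θ X in eq
  fa-⟪⟫ (Ext p ts) hθ (fa-ext q) | nothing = fa-ext (fa-⟪⟫* ts hθ q)
  fa-⟪⟫ {θ = θ} (Ext {rs = rs} p ts) hθ q | just (_ , s') with fa-subA (inst (rs ⟪ θ ⟫*)) s' q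
  ... | b , b∈s' , a∈tb = fa-ext (fa-⟪⟫* ts hθ (fa-inst (rs ⟪ θ ⟫*) b bound a∈tb))
    where
    -- s' only mentions the n bound atoms, and there are n arguments
    bound : b < length (rs ⟪ θ ⟫*)
    bound = subst (b <_) (trans (length-⊢* ts) (length-⟪⟫* rs θ)) (proj₂ (entry hθ eq p) b b∈s')

  fa-⟪⟫* : ∀ {θ : USub S} {a} → ⟨ Φ ∣ Ψ ⟩ ⊢* rs ∶ As → ⟨ Φ ∣ Ψ ⟩ ⊢ˢ θ → a ∈fa* (rs ⟪ θ ⟫*) → a ∈fa* rs
  fa-⟪⟫* (d ∷ ds) hθ (here q)  = here (fa-⟪⟫ d hθ q)
  fa-⟪⟫* (d ∷ ds) hθ (there q) = there (fa-⟪⟫* ds hθ q)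

mutual
  ty-⟪⟫ : ∀ {θ : USub S} → Γ ⊢ r ∶ A → Γ ⊢ˢ θ → Γ ⊢ (r ⟪ θ ⟫) ∶ A
  ty-⟪⟫ (Hyp p)   hθ = Hyp p
  ty-⟪⟫ Cst       hθ = Cst
  ty-⟪⟫ (→I d)    hθ = →I (ty-⟪⟫ d (θ-any-atoms hθ))
  ty-⟪⟫ (→E d e)  hθ = →E (ty-⟪⟫ d hθ) (ty-⟪⟫ e hθ)
  ty-⟪⟫ ([]I d f) hθ = []I (ty-⟪⟫ d hθ') (λ a q → f a (fa-⟪⟫ d hθ' q))
    where hθ' = θ-any-atoms hθ
  ty-⟪⟫ ([]E d e) hθ = []E (ty-⟪⟫ d (lift-θ hθ)) (ty-⟪⟫ e hθ)
  ty-⟪⟫ {θ = θ} (Ext {X = X} p ts) hθ with θ X in eq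
  ... | nothing      = Ext p (ty-⟪⟫* ts hθ)
  ... | just (_ , s') = ty-subA (proj₁ (entry hθ eq p)) (ty-inst (ty-⟪⟫* ts hθ))

  ty-⟪⟫* : ∀ {θ : USub S} → Γ ⊢* rs ∶ As → Γ ⊢ˢ θ → Γ ⊢* (rs ⟪ θ ⟫*) ∶ As
  ty-⟪⟫* []       hθ = []
  ty-⟪⟫* (d ∷ ds) hθ = ty-⟪⟫ d hθ ∷ ty-⟪⟫* ds hθ

-- Proposition 5.16.  The hypothesis IsUSub θ is implied by Γ ⊢ θ (see entry).
proposition5p16 : {S : Sig} {Γ : Ctx} {r : Term S} {A : Ty} {θ : USub S}
    → IsUSub θ → Γ ⊢ r ∶ A → Γ ⊢ˢ θ → Γ ⊢ (r ⟪ θ ⟫) ∶ A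
proposition5p16 _ = ty-⟪⟫
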